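{- Let $(P_n)_{n\ge0}$ and $(Q_n)_{n\ge0}$ be the sequences of polynomials in $m$ defined by $P_0=Q_0=0$, $P_1(m)=Q_1(m)=m$, and for $n\ge 1$: $Q_{n+1}(m)=\sum_{k=0}^{n}Q_{n-k}(m)\,P_k(m)$ and $P_{n+1}(m)=P_n(m+1)+Q_{n+1}(m)$. Then the leading coefficient of $P_2$ (coefficient of $m$) is $1$, and for every $q\ge 0$ the leading coefficient of $P_{2q+4}$ (the coefficient of $m^{q+2}$) equals $2\binom{2q+1}{q}$; equivalently it is twice the leading coefficient $\binom{2q+1}{q+1}$ of $P^T_{2q+2}$, where $P^T_0=0$, $P^T_1(m)=m$, $P^T_{n+1}(m)=P^T_n(m+1)+\sum_{k=1}^{n-1}P^T_k(m)P^T_{n-k}(m)$.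
   Context: $P_n(m)$ counts beta-normal untyped lambda terms of size $n$ with de Bruijn indices in $\{1,\dots,m\}$, $Q_n(m)$ counts those not starting with a $\lambda$, and $P^T_n(m)$ counts all untyped lambda terms of size $n$ with indices in $\{1,\dots,m\}$. -}

module Defs where

open import Data.Nat using (ℕ; zero; suc; _+_; _*_; _<_)
open import Relation.Binary.PropositionalEquality using (_≡_)
open import Data.List using (List; []; _∷_; map; zipWith; reverse; foldr)
open import Data.Product using (_×_; _,_; proj₁; proj₂)

-- Polynomials in one variable m with natural-number coefficients,
-- represented by coefficient lists, lowest degree first
-- (trailing zeros allowed; the zero polynomial is []).
Poly : Set
Poly = List ℕ

coeff : Poly → ℕ → ℕ
coeff []      _       = 0
coeff (a ∷ p) zero    = a
coeff (a ∷ p) (suc i) = coeff p i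

infixl 6 _⊕_
infixl 7 _⊗_

_⊕_ : Poly → Poly → Poly
[]      ⊕ q       = q
(a ∷ p) ⊕ []      = a ∷ p
(a ∷ p) ⊕ (b ∷ q) = (a + b) ∷ (p ⊕ q)

scale : ℕ → Poly → Poly
scale a = map (a *_)

_⊗_ : Poly → Poly → Poly
[]      ⊗ q = []
(a ∷ p) ⊗ q = scale a q ⊕ (0 ∷ (p ⊗ q))

psum : List Poly → Poly
psum = foldr _⊕_ []

varM : Poly
varM = 0 ∷ 1 ∷ []

-- shift p = the polynomial m ↦ p(m+1)
-- (p = a + m·p'  ⇒  p(m+1) = a + (m+1)·p'(m+1))
shift : Poly → Poly
shift []      = []
shift (a ∷ p) = (a ∷ []) ⊕ ((1 ∷ 1 ∷ []) ⊗ shift p)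

-- Table of (P_k , Q_k) for k = n, n-1, ..., 0 (most recent first).
-- With R = [(P_n,Q_n), …, (P_0,Q_0)], position i of R carries Q_{n-i}
-- and position i of (reverse R) carries P_i.
PQstep : List (Poly × Poly) → Poly × Poly
PQstep []            = ([] , [])
PQstep ((pn , qn) ∷ rest) =
  let R    = (pn , qn) ∷ rest
      qnew = psum (zipWith (λ x y → proj₂ x ⊗ proj₁ y) R (reverse R))
  in (shift pn ⊕ qnew , qnew)

PQtable : ℕ → List (Poly × Poly)
PQtable zero          = ([] , []) ∷ []
PQtable (suc zero)    = (varM , varM) ∷ ([] , []) ∷ []
PQtable (suc (suc n)) = PQstep (PQtable (suc n)) ∷ PQtable (suc n)

headPQ : List (Poly × Poly) → Poly × Poly
headPQ []      = ([] , [])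
headPQ (x ∷ _) = x

P : ℕ → Poly
P n = proj₁ (headPQ (PQtable n))

Q : ℕ → Poly
Q n = proj₂ (headPQ (PQtable n))

-- Table R = [P^T_n, …, P^T_0]; the full convolution Σ_{k=0}^{n} equals
-- Σ_{k=1}^{n-1} because P^T_0 = 0 (the k = 0 and k = n terms vanish).
PTstep : List Poly → Poly
PTstep []       = []
PTstep (pn ∷ rest) =
  let R = pn ∷ rest
  in shift pn ⊕ psum (zipWith _⊗_ R (reverse R))

PTtable : ℕ → List Poly
PTtable zero          = [] ∷ []
PTtable (suc zero)    = varM ∷ [] ∷ []
PTtable (suc (suc n)) = PTstep (PTtable (suc n)) ∷ PTtable (suc n)

headP : List Poly → Poly
headP []      = []
headP (x ∷ _) = x

PT : ℕ → Poly
PT n = headP (PTtable n)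

DegLe : Poly → ℕ → Set
DegLe p d = ∀ j → d < j → coeff p j ≡ 0

LeadingCoeff : Poly → ℕ → ℕ → Set
LeadingCoeff p d c = DegLe p d × coeff p d ≡ c

module Submission where

-- All of P_n, Q_n and P^T_n have degree at most ⌈n/2⌉.  Reading the defining
-- recurrences at this top degree gives recurrences for the top-coefficient
-- sequences  oddTop F j = [m^(j+1)] F_(2j+1)  and  evenTop F j = [m^j] F_(2j):
-- in a product sum Σ_{a+b=n} F_a G_b only the pairs (a, b) whose degree
-- bounds add up to ⌈(n+1)/2⌉ survive, and m ↦ m+1 preserves leading terms.
-- The odd tops of P (which equal those of Q) and of P^T satisfy the Catalan
-- recurrence; the even tops are then identified with the ballot numbers
-- ballot k j = (k+2j) C j, via the identity  Σ_{a+b=j} o_a · ballot k b =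
-- ballot (k+1) j, valid for any Catalan sequence o.  This gives
-- [m^(q+2)] P_(2q+4) = (2q+2) C (q+1) = 2 · (2q+1) C q and
-- [m^(q+1)] P^T_(2q+2) = (2q+1) C q = (2q+1) C (q+1).

open import Defs
open import Data.Nat using (ℕ; zero; suc; _+_; _*_; _∸_; _≤_; _<_; z≤n; s≤s; ⌈_/2⌉)
open import Data.Nat.Properties
open import Data.Nat.Combinatorics using (_C_; nCk+nC[k+1]≡[n+1]C[k+1]; nCk≡nC[n∸k])
open import Data.Nat.Induction using (<-rec)
open import Data.List using (List; []; _∷_; zipWith; reverse; applyUpTo; applyDownFrom)
open import Data.List.Properties using (reverse-applyDownFrom)
open import Data.Product using (_×_; _,_; proj₁; proj₂)
open import Algebra.Properties.CommutativeSemigroup +-commutativeSemigroup using (interchange; x∙yz≈y∙zx)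
open import Relation.Binary.PropositionalEquality
open ≡-Reasoning

antidiag : (ℕ → ℕ → ℕ) → ℕ → ℕ
antidiag F zero    = F 0 0
antidiag F (suc n) = F (suc n) 0 + antidiag (λ a b → F a (suc b)) n

suc-index : ∀ {a b n} → a + b ≡ n → a + suc b ≡ suc n
suc-index {a} {b} e = trans (+-suc a b) (cong suc e)

antidiag-cong : ∀ n F G → (∀ a b → a + b ≡ n → F a b ≡ G a b) → antidiag F n ≡ antidiag G n
antidiag-cong zero    F G H = H 0 0 refl
antidiag-cong (suc n) F G H =
  cong₂ _+_ (H (suc n) 0 (+-identityʳ (suc n)))
            (antidiag-cong n _ _ (λ a b e → H a (suc b) (suc-index e)))

antidiag-vanish : ∀ n F → (∀ a b → a + b ≡ n → F a b ≡ 0) → antidiag F n ≡ 0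
antidiag-vanish zero    F H = H 0 0 refl
antidiag-vanish (suc n) F H =
  cong₂ _+_ (H (suc n) 0 (+-identityʳ (suc n)))
            (antidiag-vanish n _ (λ a b e → H a (suc b) (suc-index e)))

conv : (ℕ → ℕ) → (ℕ → ℕ) → ℕ → ℕ
conv f g = antidiag (λ a b → f a * g b)

conv-cong : ∀ n f f' g g' → (∀ x → f x ≡ f' x) → (∀ x → g x ≡ g' x) → conv f g n ≡ conv f' g' n
conv-cong n f f' g g' ef eg = antidiag-cong n _ _ (λ a b _ → cong₂ _*_ (ef a) (eg b))

conv-congʳ-≤ : ∀ n f g g' → (∀ x → x ≤ n → g x ≡ g' x) → conv f g n ≡ conv f g' n
conv-congʳ-≤ n f g g' eg =
  antidiag-cong n _ _ (λ a b e → cong (f a *_) (eg b (subst (b ≤_) e (m≤n+m b a))))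

conv-last : ∀ n f g → conv f g (suc n) ≡ conv (λ x → f (suc x)) g n + f 0 * g (suc n)
conv-last zero    f g = refl
conv-last (suc n) f g = begin
  f (suc (suc n)) * g 0 + conv f (λ x → g (suc x)) (suc n)
    ≡⟨ cong (f (suc (suc n)) * g 0 +_) (conv-last n f (λ x → g (suc x))) ⟩
  f (suc (suc n)) * g 0 + (conv (λ x → f (suc x)) (λ x → g (suc x)) n + f 0 * g (suc (suc n)))
    ≡⟨ sym (+-assoc (f (suc (suc n)) * g 0) _ _) ⟩
  conv (λ x → f (suc x)) g (suc n) + f 0 * g (suc (suc n)) ∎

conv-comm : ∀ n f g → conv f g n ≡ conv g f n
conv-comm zero    f g = *-comm (f 0) (g 0)
conv-comm (suc n) f g = begin
  f (suc n) * g 0 + conv f (λ x → g (suc x)) n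
    ≡⟨ cong₂ _+_ (*-comm (f (suc n)) (g 0)) (conv-comm n f (λ x → g (suc x))) ⟩
  g 0 * f (suc n) + conv (λ x → g (suc x)) f n
    ≡⟨ +-comm (g 0 * f (suc n)) _ ⟩
  conv (λ x → g (suc x)) f n + g 0 * f (suc n)
    ≡⟨ sym (conv-last n g f) ⟩
  conv g f (suc n) ∎

conv-distribʳ : ∀ n f g g' → conv f (λ x → g x + g' x) n ≡ conv f g n + conv f g' n
conv-distribʳ zero    f g g' = *-distribˡ-+ (f 0) (g 0) (g' 0)
conv-distribʳ (suc n) f g g' = begin
  f (suc n) * (g 0 + g' 0) + conv f (λ x → g (suc x) + g' (suc x)) n
    ≡⟨ cong₂ _+_ (*-distribˡ-+ (f (suc n)) (g 0) (g' 0))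
                 (conv-distribʳ n f (λ x → g (suc x)) (λ x → g' (suc x))) ⟩
  (f (suc n) * g 0 + f (suc n) * g' 0) + (conv f (λ x → g (suc x)) n + conv f (λ x → g' (suc x)) n)
    ≡⟨ interchange (f (suc n) * g 0) (f (suc n) * g' 0) _ _ ⟩
  conv f g (suc n) + conv f g' (suc n) ∎

conv-distribˡ : ∀ n f f' g → conv (λ x → f x + f' x) g n ≡ conv f g n + conv f' g n
conv-distribˡ n f f' g = begin
  conv (λ x → f x + f' x) g n  ≡⟨ conv-comm n _ g ⟩
  conv g (λ x → f x + f' x) n  ≡⟨ conv-distribʳ n g f f' ⟩
  conv g f n + conv g f' n     ≡⟨ cong₂ _+_ (conv-comm n g f) (conv-comm n g f') ⟩
  conv f g n + conv f' g n     ∎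

conv-scaleʳ : ∀ n f g c → conv f (λ x → g x * c) n ≡ conv f g n * c
conv-scaleʳ zero    f g c = sym (*-assoc (f 0) (g 0) c)
conv-scaleʳ (suc n) f g c = begin
  f (suc n) * (g 0 * c) + conv f (λ x → g (suc x) * c) n
    ≡⟨ cong₂ _+_ (sym (*-assoc (f (suc n)) (g 0) c)) (conv-scaleʳ n f (λ x → g (suc x)) c) ⟩
  f (suc n) * g 0 * c + conv f (λ x → g (suc x)) n * c
    ≡⟨ sym (*-distribʳ-+ c (f (suc n) * g 0) _) ⟩
  conv f g (suc n) * c ∎

conv-scaleˡ : ∀ n f g c → conv f (λ x → c * g x) n ≡ c * conv f g n
conv-scaleˡ n f g c = begin
  conv f (λ x → c * g x) n  ≡⟨ conv-cong n f f _ _ (λ _ → refl) (λ x → *-comm c (g x)) ⟩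
  conv f (λ x → g x * c) n  ≡⟨ conv-scaleʳ n f g c ⟩
  conv f g n * c            ≡⟨ *-comm _ c ⟩
  c * conv f g n            ∎

conv-assoc : ∀ n f g h → conv f (conv g h) n ≡ conv (conv f g) h n
conv-assoc zero    f g h = sym (*-assoc (f 0) (g 0) (h 0))
conv-assoc (suc n) f g h = begin
  f (suc n) * (g 0 * h 0) + conv f (λ i → g (suc i) * h 0 + conv g (λ x → h (suc x)) i) n
    ≡⟨ cong (f (suc n) * (g 0 * h 0) +_) (conv-distribʳ n f _ _) ⟩
  f (suc n) * (g 0 * h 0) + (conv f (λ i → g (suc i) * h 0) n + conv f (conv g (λ x → h (suc x))) n)
    ≡⟨ cong₂ (λ u v → f (suc n) * (g 0 * h 0) + (u + v))
             (conv-scaleʳ n f (λ i → g (suc i)) (h 0)) (conv-assoc n f g (λ x → h (suc x))) ⟩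
  f (suc n) * (g 0 * h 0) + (X * h 0 + Y)
    ≡⟨ sym (+-assoc (f (suc n) * (g 0 * h 0)) (X * h 0) Y) ⟩
  f (suc n) * (g 0 * h 0) + X * h 0 + Y
    ≡⟨ cong (λ u → u + X * h 0 + Y) (sym (*-assoc (f (suc n)) (g 0) (h 0))) ⟩
  f (suc n) * g 0 * h 0 + X * h 0 + Y
    ≡⟨ cong (_+ Y) (sym (*-distribʳ-+ (h 0) (f (suc n) * g 0) X)) ⟩
  conv (conv f g) h (suc n) ∎
  where
  X Y : ℕ
  X = conv f (λ x → g (suc x)) n
  Y = conv (conv f g) (λ x → h (suc x)) n

-- Structural doubling, so that double (suc j) reduces to suc (suc (double j)).
double : ℕ → ℕ
double zero    = zero
double (suc n) = suc (suc (double n))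

double≡n+n : ∀ n → double n ≡ n + n
double≡n+n zero    = refl
double≡n+n (suc n) = cong suc (trans (cong suc (double≡n+n n)) (sym (+-suc n n)))

double≡2* : ∀ n → double n ≡ 2 * n
double≡2* n = trans (double≡n+n n) (cong (n +_) (sym (+-identityʳ n)))

regroup : ∀ x y E O → x + (y + (E + O)) ≡ (x + E) + (y + O)
regroup x y E O = trans (sym (+-assoc x y (E + O))) (interchange x y E O)

-- The parity split of an antidiagonal: a+b = 2j+1 forces exactly one of a, b
-- to be odd, and a+b = 2j+2 forces both to have the same parity.
antidiag-split-odd : ∀ j F →
  antidiag F (suc (double j))
    ≡ antidiag (λ a b → F (suc (double a)) (double b)) j + antidiag (λ a b → F (double a) (suc (double b))) j
antidiag-split-odd zero    F = refl
antidiag-split-odd (suc j) F =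
  trans (cong (λ z → F (suc (double (suc j))) 0 + (F (double (suc j)) 1 + z))
              (antidiag-split-odd j (λ a b → F a (suc (suc b)))))
        (regroup (F (suc (double (suc j))) 0) (F (double (suc j)) 1)
                 (antidiag (λ a b → F (suc (double a)) (suc (suc (double b)))) j)
                 (antidiag (λ a b → F (double a) (suc (suc (suc (double b))))) j))

antidiag-split-even : ∀ j F →
  antidiag F (double (suc j))
    ≡ antidiag (λ a b → F (double a) (double b)) (suc j) + antidiag (λ a b → F (suc (double a)) (suc (double b))) j
antidiag-split-even zero    F = begin
  F 2 0 + (F 1 1 + F 0 2)        ≡⟨ cong (λ z → F 2 0 + (F 1 1 + z)) (sym (+-identityʳ (F 0 2))) ⟩
  F 2 0 + (F 1 1 + (F 0 2 + 0))  ≡⟨ regroup (F 2 0) (F 1 1) (F 0 2) 0 ⟩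
  (F 2 0 + F 0 2) + (F 1 1 + 0)  ≡⟨ cong (F 2 0 + F 0 2 +_) (+-identityʳ (F 1 1)) ⟩
  (F 2 0 + F 0 2) + F 1 1        ∎
antidiag-split-even (suc j) F =
  trans (cong (λ z → F (double (suc (suc j))) 0 + (F (suc (double (suc j))) 1 + z))
              (antidiag-split-even j (λ a b → F a (suc (suc b)))))
        (regroup (F (double (suc (suc j))) 0) (F (suc (double (suc j))) 1)
                 (antidiag (λ a b → F (double a) (suc (suc (double b)))) (suc j))
                 (antidiag (λ a b → F (suc (double a)) (suc (suc (suc (double b))))) j))

middle-binomials : ∀ j → suc (double j) C suc j ≡ suc (double j) C j
middle-binomials j = trans (nCk≡nC[n∸k] (s≤s j≤2j)) (cong (suc (double j) C_) 2j∸j≡j)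
  where
  j≤2j : j ≤ double j
  j≤2j = subst (j ≤_) (sym (double≡n+n j)) (m≤m+n j j)
  2j∸j≡j : double j ∸ j ≡ j
  2j∸j≡j = trans (cong (_∸ j) (double≡n+n j)) (m+n∸n≡m j j)

-- Ballot numbers: ballot k j = (k+2j) C j is the coefficient of x^j in c(x)^k,
-- c being the generating function of the Catalan numbers.
ballot : ℕ → ℕ → ℕ
ballot k j = (k + double j) C j

ballot-pascal : ∀ k j → ballot (suc k) (suc j) ≡ ballot k (suc j) + ballot (suc (suc k)) j
ballot-pascal k j = begin
  suc N C suc j         ≡⟨ sym (nCk+nC[k+1]≡[n+1]C[k+1] N j) ⟩
  N C j + N C suc j     ≡⟨ +-comm (N C j) _ ⟩
  N C suc j + N C j     ≡⟨ cong (λ z → N C suc j + z C j) N≡ ⟩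
  ballot k (suc j) + ballot (suc (suc k)) j ∎
  where
  N : ℕ
  N = k + suc (suc (double j))
  N≡ : N ≡ suc (suc (k + double j))
  N≡ = trans (+-suc k (suc (double j))) (cong suc (+-suc k (double j)))

ballot-central : ∀ j → ballot 0 (suc j) ≡ 2 * ballot 1 j
ballot-central j = begin
  suc N C suc j      ≡⟨ sym (nCk+nC[k+1]≡[n+1]C[k+1] N j) ⟩
  N C j + N C suc j  ≡⟨ cong (N C j +_) (middle-binomials j) ⟩
  N C j + N C j      ≡⟨ cong (N C j +_) (sym (+-identityʳ (N C j))) ⟩
  2 * ballot 1 j     ∎
  where
  N : ℕ
  N = suc (double j)

module Catalan (o : ℕ → ℕ) (o-zero : o 0 ≡ 1) (o-suc : ∀ j → o (suc j) ≡ conv o o j) where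

  -- c(x) · c(x)^k = c(x)^(k+1), coefficientwise.
  conv-ballot : ∀ j k → conv o (ballot k) j ≡ ballot (suc k) j
  conv-ballot = <-rec (λ j → ∀ k → conv o (ballot k) j ≡ ballot (suc k) j) step
    where
    step : ∀ j → (∀ {i} → i < j → ∀ k → conv o (ballot k) i ≡ ballot (suc k) i)
         → ∀ k → conv o (ballot k) j ≡ ballot (suc k) j
    step zero    _  k = trans (cong (_* ballot k 0) o-zero) (+-identityʳ _)
    step (suc n) IH k = begin
      conv o (ballot k) (suc n)
        ≡⟨ conv-comm (suc n) o (ballot k) ⟩
      ballot k (suc n) * o 0 + conv (ballot k) (λ x → o (suc x)) n
        ≡⟨ cong₂ _+_ (trans (cong (ballot k (suc n) *_) o-zero) (*-identityʳ _))
                     (conv-cong n (ballot k) (ballot k) _ _ (λ _ → refl) o-suc) ⟩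
      ballot k (suc n) + conv (ballot k) (conv o o) n
        ≡⟨ cong (ballot k (suc n) +_) tail ⟩
      ballot k (suc n) + ballot (suc (suc k)) n
        ≡⟨ sym (ballot-pascal k n) ⟩
      ballot (suc k) (suc n) ∎
      where
      tail : conv (ballot k) (conv o o) n ≡ ballot (suc (suc k)) n
      tail = begin
        conv (ballot k) (conv o o) n  ≡⟨ conv-assoc n (ballot k) o o ⟩
        conv (conv (ballot k) o) o n  ≡⟨ conv-comm n _ o ⟩
        conv o (conv (ballot k) o) n
          ≡⟨ conv-congʳ-≤ n o _ _ (λ x x≤n → trans (conv-comm x (ballot k) o) (IH (s≤s x≤n) k)) ⟩
        conv o (ballot (suc k)) n     ≡⟨ IH (n<1+n n) (suc k) ⟩
        ballot (suc (suc k)) n        ∎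

  conv-shifted-ballot : ∀ k n f → f 0 ≡ 0 → (∀ x → x ≤ n → f (suc x) ≡ ballot k x)
                      → conv o f (suc n) ≡ ballot (suc k) n
  conv-shifted-ballot k n f f-zero f-suc = begin
    o (suc n) * f 0 + conv o (λ x → f (suc x)) n
      ≡⟨ cong₂ _+_ (trans (cong (o (suc n) *_) f-zero) (*-zeroʳ (o (suc n))))
                   (conv-congʳ-≤ n o _ _ f-suc) ⟩
    conv o (ballot k) n  ≡⟨ conv-ballot n k ⟩
    ballot (suc k) n     ∎

  ballot-one-suc : ∀ j → ballot 1 (suc j) ≡ o (suc j) + 2 * ballot 2 j
  ballot-one-suc j = begin
    ballot 1 (suc j)
      ≡⟨ sym (conv-ballot (suc j) 0) ⟩
    o (suc j) * 1 + conv o (λ x → ballot 0 (suc x)) j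
      ≡⟨ cong₂ _+_ (*-identityʳ _) (conv-cong j o o _ _ (λ _ → refl) ballot-central) ⟩
    o (suc j) + conv o (λ x → 2 * ballot 1 x) j
      ≡⟨ cong (o (suc j) +_) (conv-scaleˡ j o (ballot 1) 2) ⟩
    o (suc j) + 2 * conv o (ballot 1) j
      ≡⟨ cong (λ z → o (suc j) + 2 * z) (conv-ballot j 1) ⟩
    o (suc j) + 2 * ballot 2 j ∎

  symmetric-solution : (f : ℕ → ℕ) → f 0 ≡ 0
                     → (∀ j → f (suc j) ≡ o j + (conv o f j + conv f o j))
                     → ∀ j → f (suc j) ≡ ballot 1 j
  symmetric-solution f f-zero f-suc = <-rec (λ j → f (suc j) ≡ ballot 1 j) step
    where
    step : ∀ j → (∀ {i} → i < j → f (suc i) ≡ ballot 1 i) → f (suc j) ≡ ballot 1 j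
    step zero _ = begin
      f 1                              ≡⟨ f-suc 0 ⟩
      o 0 + (o 0 * f 0 + f 0 * o 0)    ≡⟨ cong (λ z → o 0 + (o 0 * z + z * o 0)) f-zero ⟩
      o 0 + (o 0 * 0 + 0)              ≡⟨ cong (λ z → o 0 + (z + 0)) (*-zeroʳ (o 0)) ⟩
      o 0 + 0                          ≡⟨ trans (+-identityʳ _) o-zero ⟩
      ballot 1 0                       ∎
    step (suc n) IH = begin
      f (suc (suc n))
        ≡⟨ f-suc (suc n) ⟩
      o (suc n) + (conv o f (suc n) + conv f o (suc n))
        ≡⟨ cong (λ z → o (suc n) + (conv o f (suc n) + z)) (conv-comm (suc n) f o) ⟩
      o (suc n) + (conv o f (suc n) + conv o f (suc n))
        ≡⟨ cong (λ z → o (suc n) + (z + z)) (conv-shifted-ballot 1 n f f-zero (λ x x≤n → IH (s≤s x≤n))) ⟩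
      o (suc n) + (ballot 2 n + ballot 2 n)
        ≡⟨ cong (λ z → o (suc n) + (ballot 2 n + z)) (sym (+-identityʳ _)) ⟩
      o (suc n) + 2 * ballot 2 n
        ≡⟨ sym (ballot-one-suc n) ⟩
      ballot 1 (suc n) ∎

  -- The key observation is
  -- e = y + o↑ with o↑ the sequence o shifted by one place, so that
  -- o (j+1) + conv y o (j+1) = conv e o (j+1).
  coupled-solution : (e y : ℕ → ℕ) → e 0 ≡ 0 → y 0 ≡ 0
                   → (∀ j → e (suc j) ≡ o j + y (suc j))
                   → (∀ j → y (suc j) ≡ conv o e j + conv y o j)
                   → ∀ j → e (suc j) ≡ ballot 0 j
  coupled-solution e y e-zero y-zero e-suc y-suc = <-rec (λ j → e (suc j) ≡ ballot 0 j) step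
    where
    o↑ : ℕ → ℕ
    o↑ zero    = 0
    o↑ (suc m) = o m

    e≡y+o↑ : ∀ x → e x ≡ y x + o↑ x
    e≡y+o↑ zero    = trans e-zero (sym (trans (+-identityʳ (y 0)) y-zero))
    e≡y+o↑ (suc m) = trans (e-suc m) (+-comm (o m) _)

    conv-o↑ : ∀ n → conv o↑ o (suc n) ≡ o (suc n)
    conv-o↑ n = begin
      conv o↑ o (suc n)          ≡⟨ conv-comm (suc n) o↑ o ⟩
      o (suc n) * 0 + conv o o n ≡⟨ cong (_+ conv o o n) (*-zeroʳ (o (suc n))) ⟩
      conv o o n                 ≡⟨ sym (o-suc n) ⟩
      o (suc n)                  ∎

    step : ∀ j → (∀ {i} → i < j → e (suc i) ≡ ballot 0 i) → e (suc j) ≡ ballot 0 j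
    step zero _ = begin
      e 1                            ≡⟨ trans (e-suc 0) (cong (o 0 +_) (y-suc 0)) ⟩
      o 0 + (o 0 * e 0 + y 0 * o 0)  ≡⟨ cong₂ (λ u v → o 0 + (o 0 * u + v * o 0)) e-zero y-zero ⟩
      o 0 + (o 0 * 0 + 0)            ≡⟨ cong (λ z → o 0 + (z + 0)) (*-zeroʳ (o 0)) ⟩
      o 0 + 0                        ≡⟨ trans (+-identityʳ _) o-zero ⟩
      ballot 0 0                     ∎
    step (suc n) IH = begin
      e (suc (suc n))
        ≡⟨ trans (e-suc (suc n)) (cong (o (suc n) +_) (y-suc (suc n))) ⟩
      o (suc n) + (c + conv y o (suc n))
        ≡⟨ x∙yz≈y∙zx (o (suc n)) c (conv y o (suc n)) ⟩
      c + (conv y o (suc n) + o (suc n))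
        ≡⟨ cong (λ z → c + (conv y o (suc n) + z)) (sym (conv-o↑ n)) ⟩
      c + (conv y o (suc n) + conv o↑ o (suc n))
        ≡⟨ cong (c +_) (sym (conv-distribˡ (suc n) y o↑ o)) ⟩
      c + conv (λ x → y x + o↑ x) o (suc n)
        ≡⟨ cong (c +_) (sym (conv-cong (suc n) e _ o o e≡y+o↑ (λ _ → refl))) ⟩
      c + conv e o (suc n)
        ≡⟨ cong (c +_) (conv-comm (suc n) e o) ⟩
      c + c
        ≡⟨ cong (λ z → z + z) (conv-shifted-ballot 0 n e e-zero (λ x x≤n → IH (s≤s x≤n))) ⟩
      ballot 1 n + ballot 1 n
        ≡⟨ cong (ballot 1 n +_) (sym (+-identityʳ _)) ⟩
      2 * ballot 1 n
        ≡⟨ sym (ballot-central n) ⟩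
      ballot 0 (suc n) ∎
      where
      c : ℕ
      c = conv o e (suc n)

coeff-⊕ : ∀ p q j → coeff (p ⊕ q) j ≡ coeff p j + coeff q j
coeff-⊕ []      q       j       = refl
coeff-⊕ (a ∷ p) []      j       = sym (+-identityʳ _)
coeff-⊕ (a ∷ p) (b ∷ q) zero    = refl
coeff-⊕ (a ∷ p) (b ∷ q) (suc j) = coeff-⊕ p q j

coeff-scale : ∀ a q j → coeff (scale a q) j ≡ a * coeff q j
coeff-scale a []      j       = sym (*-zeroʳ a)
coeff-scale a (b ∷ q) zero    = refl
coeff-scale a (b ∷ q) (suc j) = coeff-scale a q j

coeff-∷⊗ : ∀ x p q j → coeff ((x ∷ p) ⊗ q) j ≡ x * coeff q j + coeff (0 ∷ (p ⊗ q)) j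
coeff-∷⊗ x p q j =
  trans (coeff-⊕ (scale x q) _ j) (cong (_+ coeff (0 ∷ (p ⊗ q)) j) (coeff-scale x q j))

-- p represents the zero polynomial (it may still be a non-empty list).
IsZero : Poly → Set
IsZero p = ∀ j → coeff p j ≡ 0

IsZero-0∷ : ∀ p → IsZero p → IsZero (0 ∷ p)
IsZero-0∷ p Z zero    = refl
IsZero-0∷ p Z (suc j) = Z j

IsZero-⊗ˡ : ∀ p q → IsZero p → IsZero (p ⊗ q)
IsZero-⊗ˡ []      q Z j = refl
IsZero-⊗ˡ (x ∷ p) q Z j =
  trans (coeff-∷⊗ x p q j)
        (cong₂ _+_ (cong (_* coeff q j) (Z 0)) (IsZero-0∷ _ (IsZero-⊗ˡ p q (λ i → Z (suc i))) j))

IsZero-⊗ʳ : ∀ p q → IsZero q → IsZero (p ⊗ q)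
IsZero-⊗ʳ []      q Z j = refl
IsZero-⊗ʳ (x ∷ p) q Z j =
  trans (coeff-∷⊗ x p q j)
        (cong₂ _+_ (trans (cong (x *_) (Z j)) (*-zeroʳ x)) (IsZero-0∷ _ (IsZero-⊗ʳ p q Z) j))

DegLe-mono : ∀ p a b → DegLe p a → a ≤ b → DegLe p b
DegLe-mono p a b D a≤b j b<j = D j (≤-<-trans a≤b b<j)

⊗-leading : ∀ p q a b → DegLe p a → DegLe q b
          → DegLe (p ⊗ q) (a + b) × coeff (p ⊗ q) (a + b) ≡ coeff p a * coeff q b
⊗-leading []      q a       b Dp Dq = (λ _ _ → refl) , refl
⊗-leading (x ∷ p) q zero    b Dp Dq = degree , top
  where
  -- p = 0, so (x ∷ p) ⊗ q has the coefficients of x · q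
  constant : ∀ j → coeff ((x ∷ p) ⊗ q) j ≡ x * coeff q j
  constant j = trans (coeff-∷⊗ x p q j)
    (trans (cong (x * coeff q j +_) (IsZero-0∷ _ (IsZero-⊗ˡ p q (λ i → Dp (suc i) (s≤s z≤n))) j))
           (+-identityʳ _))
  degree : DegLe ((x ∷ p) ⊗ q) b
  degree j b<j = trans (constant j) (trans (cong (x *_) (Dq j b<j)) (*-zeroʳ x))
  top : coeff ((x ∷ p) ⊗ q) b ≡ x * coeff q b
  top = constant b
⊗-leading (x ∷ p) q (suc a) b Dp Dq = degree , top
  where
  IH : DegLe (p ⊗ q) (a + b) × coeff (p ⊗ q) (a + b) ≡ coeff p a * coeff q b
  IH = ⊗-leading p q a b (λ j a<j → Dp (suc j) (s≤s a<j)) Dq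
  high : ∀ j → b ≤ j → coeff ((x ∷ p) ⊗ q) (suc j) ≡ coeff (p ⊗ q) j
  high j b≤j = trans (coeff-∷⊗ x p q (suc j))
                     (cong (_+ coeff (p ⊗ q) j) (trans (cong (x *_) (Dq (suc j) (s≤s b≤j))) (*-zeroʳ x)))
  degree : DegLe ((x ∷ p) ⊗ q) (suc a + b)
  degree zero    ()
  degree (suc j) (s≤s a+b<j) =
    trans (high j (≤-trans (m≤n+m b a) (<⇒≤ a+b<j))) (proj₁ IH j a+b<j)
  top : coeff ((x ∷ p) ⊗ q) (suc a + b) ≡ coeff p a * coeff q b
  top = trans (high (a + b) (m≤n+m b a)) (proj₂ IH)

⊗-degree : ∀ p q a b → DegLe p a → DegLe q b → DegLe (p ⊗ q) (a + b)
⊗-degree p q a b Dp Dq = proj₁ (⊗-leading p q a b Dp Dq)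

⊗-top : ∀ p q a b D → DegLe p a → DegLe q b → a + b ≡ D → coeff (p ⊗ q) D ≡ coeff p a * coeff q b
⊗-top p q a b .(a + b) Dp Dq refl = proj₂ (⊗-leading p q a b Dp Dq)

IsZero-shift : ∀ p → IsZero p → IsZero (shift p)
IsZero-shift []      Z j = refl
IsZero-shift (a ∷ p) Z j =
  trans (coeff-⊕ (a ∷ []) ((1 ∷ 1 ∷ []) ⊗ shift p) j)
        (cong₂ _+_ (constant j) (IsZero-⊗ʳ (1 ∷ 1 ∷ []) (shift p) (IsZero-shift p (λ i → Z (suc i))) j))
  where
  constant : ∀ j → coeff (a ∷ []) j ≡ 0
  constant zero    = Z 0
  constant (suc j) = refl

shift-leading : ∀ p d → DegLe p d → DegLe (shift p) d × coeff (shift p) d ≡ coeff p d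
shift-leading []      d       D = (λ _ _ → refl) , refl
shift-leading (a ∷ p) zero    D = degree , top
  where
  rest-zero : IsZero ((1 ∷ 1 ∷ []) ⊗ shift p)
  rest-zero = IsZero-⊗ʳ (1 ∷ 1 ∷ []) (shift p) (IsZero-shift p (λ i → D (suc i) (s≤s z≤n)))
  degree : DegLe (shift (a ∷ p)) 0
  degree zero    ()
  degree (suc j) _ = trans (coeff-⊕ (a ∷ []) ((1 ∷ 1 ∷ []) ⊗ shift p) (suc j)) (rest-zero (suc j))
  top : coeff (shift (a ∷ p)) 0 ≡ a
  top = trans (coeff-⊕ (a ∷ []) ((1 ∷ 1 ∷ []) ⊗ shift p) 0)
              (trans (cong (a +_) (rest-zero 0)) (+-identityʳ a))
shift-leading (a ∷ p) (suc d) D = degree , top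
  where
  IH : DegLe (shift p) d × coeff (shift p) d ≡ coeff p d
  IH = shift-leading p d (λ j d<j → D (suc j) (s≤s d<j))
  m+1-degree : DegLe (1 ∷ 1 ∷ []) 1
  m+1-degree zero          ()
  m+1-degree (suc zero)    (s≤s ())
  m+1-degree (suc (suc j)) _ = refl
  product : DegLe ((1 ∷ 1 ∷ []) ⊗ shift p) (1 + d)
            × coeff ((1 ∷ 1 ∷ []) ⊗ shift p) (1 + d) ≡ 1 * coeff (shift p) d
  product = ⊗-leading (1 ∷ 1 ∷ []) (shift p) 1 d m+1-degree (proj₁ IH)
  degree : DegLe (shift (a ∷ p)) (suc d)
  degree zero    ()
  degree (suc j) d<j = trans (coeff-⊕ (a ∷ []) ((1 ∷ 1 ∷ []) ⊗ shift p) (suc j)) (proj₁ product (suc j) d<j)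
  top : coeff (shift (a ∷ p)) (suc d) ≡ coeff p d
  top = trans (coeff-⊕ (a ∷ []) ((1 ∷ 1 ∷ []) ⊗ shift p) (suc d))
              (trans (proj₂ product) (trans (*-identityˡ _) (proj₂ IH)))

prodSum : (ℕ → Poly) → (ℕ → Poly) → ℕ → ℕ → ℕ
prodSum F G n D = antidiag (λ a b → coeff (F a ⊗ G b) D) n

coeff-psum-zipWith : ∀ {X Y : Set} (g : X → Y → Poly) (u : ℕ → X) (v : ℕ → Y) n D →
  coeff (psum (zipWith g (applyDownFrom u (suc n)) (applyUpTo v (suc n)))) D
    ≡ antidiag (λ a b → coeff (g (u a) (v b)) D) n
coeff-psum-zipWith g u v zero    D = trans (coeff-⊕ (g (u 0) (v 0)) [] D) (+-identityʳ _)
coeff-psum-zipWith g u v (suc n) D =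
  trans (coeff-⊕ (g (u (suc n)) (v 0)) _ D)
        (cong (coeff (g (u (suc n)) (v 0)) D +_) (coeff-psum-zipWith g u (λ k → v (suc k)) n D))

PQtable≡ : ∀ n → PQtable n ≡ applyDownFrom (λ k → (P k , Q k)) (suc n)
PQtable≡ zero          = refl
PQtable≡ (suc zero)    = refl
PQtable≡ (suc (suc n)) = cong (PQstep (PQtable (suc n)) ∷_) (PQtable≡ (suc n))

PTtable≡ : ∀ n → PTtable n ≡ applyDownFrom PT (suc n)
PTtable≡ zero          = refl
PTtable≡ (suc zero)    = refl
PTtable≡ (suc (suc n)) = cong (PTstep (PTtable (suc n)) ∷_) (PTtable≡ (suc n))

Q-rec : ∀ n D → coeff (Q (suc (suc n))) D ≡ prodSum Q P (suc n) D
Q-rec n D = begin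
  coeff (Q (suc (suc n))) D
    ≡⟨ cong (λ T → coeff (proj₂ (PQstep T)) D) (PQtable≡ (suc n)) ⟩
  coeff (psum (zipWith (λ x y → proj₂ x ⊗ proj₁ y) R (reverse R))) D
    ≡⟨ cong (λ L → coeff (psum (zipWith (λ x y → proj₂ x ⊗ proj₁ y) R L)) D)
            (reverse-applyDownFrom (λ k → (P k , Q k)) (suc (suc n))) ⟩
  coeff (psum (zipWith (λ x y → proj₂ x ⊗ proj₁ y) R (applyUpTo (λ k → (P k , Q k)) (suc (suc n))))) D
    ≡⟨ coeff-psum-zipWith (λ x y → proj₂ x ⊗ proj₁ y) (λ k → (P k , Q k)) (λ k → (P k , Q k)) (suc n) D ⟩
  prodSum Q P (suc n) D ∎
  where
  R : List (Poly × Poly)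
  R = applyDownFrom (λ k → (P k , Q k)) (suc (suc n))

P≡shift⊕Q : ∀ n → P (suc (suc n)) ≡ shift (P (suc n)) ⊕ Q (suc (suc n))
P≡shift⊕Q zero    = refl
P≡shift⊕Q (suc n) = refl

P-rec : ∀ n D → coeff (P (suc (suc n))) D ≡ coeff (shift (P (suc n))) D + prodSum Q P (suc n) D
P-rec n D = begin
  coeff (P (suc (suc n))) D
    ≡⟨ cong (λ p → coeff p D) (P≡shift⊕Q n) ⟩
  coeff (shift (P (suc n)) ⊕ Q (suc (suc n))) D
    ≡⟨ coeff-⊕ (shift (P (suc n))) (Q (suc (suc n))) D ⟩
  coeff (shift (P (suc n))) D + coeff (Q (suc (suc n))) D
    ≡⟨ cong (coeff (shift (P (suc n))) D +_) (Q-rec n D) ⟩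
  coeff (shift (P (suc n))) D + prodSum Q P (suc n) D ∎

PT-rec : ∀ n D → coeff (PT (suc (suc n))) D ≡ coeff (shift (PT (suc n))) D + prodSum PT PT (suc n) D
PT-rec n D = begin
  coeff (PT (suc (suc n))) D
    ≡⟨ cong (λ T → coeff (PTstep T) D) (PTtable≡ (suc n)) ⟩
  coeff (shift (PT (suc n)) ⊕ psum (zipWith _⊗_ R (reverse R))) D
    ≡⟨ coeff-⊕ (shift (PT (suc n))) _ D ⟩
  coeff (shift (PT (suc n))) D + coeff (psum (zipWith _⊗_ R (reverse R))) D
    ≡⟨ cong (λ L → coeff (shift (PT (suc n))) D + coeff (psum (zipWith _⊗_ R L)) D)
            (reverse-applyDownFrom PT (suc (suc n))) ⟩
  coeff (shift (PT (suc n))) D + coeff (psum (zipWith _⊗_ R (applyUpTo PT (suc (suc n))))) D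
    ≡⟨ cong (coeff (shift (PT (suc n))) D +_) (coeff-psum-zipWith _⊗_ PT PT (suc n) D) ⟩
  coeff (shift (PT (suc n))) D + prodSum PT PT (suc n) D ∎
  where
  R : List Poly
  R = applyDownFrom PT (suc (suc n))

-- The degree bounds ⌈a/2⌉ and ⌈b/2⌉ of two factors add up to at most
-- ⌈(a+b+1)/2⌉, with equality unless a and b are both even.
⌈/2⌉-+ : ∀ a b → ⌈ a /2⌉ + ⌈ b /2⌉ ≤ ⌈ suc (a + b) /2⌉
⌈/2⌉-+ zero          b = ⌈n/2⌉-mono (n≤1+n b)
⌈/2⌉-+ (suc zero)    b = ≤-refl
⌈/2⌉-+ (suc (suc a)) b = s≤s (⌈/2⌉-+ a b)

HalfDegreeUpTo : (ℕ → Poly) → ℕ → Set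
HalfDegreeUpTo F n = ∀ k → k ≤ n → DegLe (F k) ⌈ k /2⌉

HalfDegree : (ℕ → Poly) → Set
HalfDegree F = ∀ n → DegLe (F n) ⌈ n /2⌉

prodSum-degree : ∀ F G n → HalfDegreeUpTo F n → HalfDegreeUpTo G n
               → ∀ D → ⌈ suc n /2⌉ < D → prodSum F G n D ≡ 0
prodSum-degree F G n dF dG D lt = antidiag-vanish n _ term
  where
  term : ∀ a b → a + b ≡ n → coeff (F a ⊗ G b) D ≡ 0
  term a b e =
    ⊗-degree (F a) (G b) ⌈ a /2⌉ ⌈ b /2⌉
             (dF a (subst (a ≤_) e (m≤m+n a b))) (dG b (subst (b ≤_) e (m≤n+m b a)))
             D (≤-<-trans (subst (λ s → ⌈ a /2⌉ + ⌈ b /2⌉ ≤ ⌈ suc s /2⌉) e (⌈/2⌉-+ a b)) lt)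

shift-degree : ∀ (F : ℕ → Poly) n → DegLe (F (suc n)) ⌈ suc n /2⌉ → DegLe (shift (F (suc n))) ⌈ suc (suc n) /2⌉
shift-degree F n D =
  DegLe-mono (shift (F (suc n))) ⌈ suc n /2⌉ ⌈ suc (suc n) /2⌉
             (proj₁ (shift-leading (F (suc n)) ⌈ suc n /2⌉ D)) (⌈n/2⌉-mono {suc n} (n≤1+n (suc n)))

varM-degree : DegLe varM 1
varM-degree zero          ()
varM-degree (suc zero)    (s≤s ())
varM-degree (suc (suc j)) _ = refl

PQ-degree : ∀ n → DegLe (P n) ⌈ n /2⌉ × DegLe (Q n) ⌈ n /2⌉
PQ-degree = <-rec (λ n → DegLe (P n) ⌈ n /2⌉ × DegLe (Q n) ⌈ n /2⌉) step
  where
  step : ∀ n → (∀ {k} → k < n → DegLe (P k) ⌈ k /2⌉ × DegLe (Q k) ⌈ k /2⌉)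
       → DegLe (P n) ⌈ n /2⌉ × DegLe (Q n) ⌈ n /2⌉
  step zero          _  = (λ _ _ → refl) , (λ _ _ → refl)
  step (suc zero)    _  = varM-degree , varM-degree
  step (suc (suc n)) IH = P-degree , Q-degree
    where
    Q-degree : DegLe (Q (suc (suc n))) ⌈ suc (suc n) /2⌉
    Q-degree D lt = trans (Q-rec n D)
      (prodSum-degree Q P (suc n) (λ k k≤ → proj₂ (IH (s≤s k≤))) (λ k k≤ → proj₁ (IH (s≤s k≤))) D lt)
    P-degree : DegLe (P (suc (suc n))) ⌈ suc (suc n) /2⌉
    P-degree D lt = trans (P-rec n D)
      (cong₂ _+_ (shift-degree P n (proj₁ (IH {suc n} ≤-refl)) D lt) (trans (sym (Q-rec n D)) (Q-degree D lt)))

PT-degree : HalfDegree PT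
PT-degree = <-rec (λ n → DegLe (PT n) ⌈ n /2⌉) step
  where
  step : ∀ n → (∀ {k} → k < n → DegLe (PT k) ⌈ k /2⌉) → DegLe (PT n) ⌈ n /2⌉
  step zero          _  = λ _ _ → refl
  step (suc zero)    _  = varM-degree
  step (suc (suc n)) IH D lt = trans (PT-rec n D)
    (cong₂ _+_ (shift-degree PT n (IH {suc n} ≤-refl) D lt)
               (prodSum-degree PT PT (suc n) (λ k k≤ → IH (s≤s k≤)) (λ k k≤ → IH (s≤s k≤)) D lt))

P-degree : HalfDegree P
P-degree n = proj₁ (PQ-degree n)

Q-degree : HalfDegree Q
Q-degree n = proj₂ (PQ-degree n)

⌈double/2⌉ : ∀ i → ⌈ double i /2⌉ ≡ i
⌈double/2⌉ zero    = refl
⌈double/2⌉ (suc i) = cong suc (⌈double/2⌉ i)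

⌈suc-double/2⌉ : ∀ i → ⌈ suc (double i) /2⌉ ≡ suc i
⌈suc-double/2⌉ zero    = refl
⌈suc-double/2⌉ (suc i) = cong suc (⌈suc-double/2⌉ i)

even-degree : ∀ F → HalfDegree F → ∀ i → DegLe (F (double i)) i
even-degree F dF i = subst (DegLe (F (double i))) (⌈double/2⌉ i) (dF (double i))

odd-degree : ∀ F → HalfDegree F → ∀ i → DegLe (F (suc (double i))) (suc i)
odd-degree F dF i = subst (DegLe (F (suc (double i)))) (⌈suc-double/2⌉ i) (dF (suc (double i)))

evenTop : (ℕ → Poly) → ℕ → ℕ
evenTop F i = coeff (F (double i)) i

oddTop : (ℕ → Poly) → ℕ → ℕ
oddTop F i = coeff (F (suc (double i))) (suc i)

-- Top coefficient of a product sum over an odd total index: exactly one of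
-- the two factors has odd index, and every term reaches the top degree.
prodSum-top-odd : ∀ F G → HalfDegree F → HalfDegree G → ∀ j →
  prodSum F G (suc (double j)) (suc j)
    ≡ conv (oddTop F) (evenTop G) j + conv (evenTop F) (oddTop G) j
prodSum-top-odd F G dF dG j =
  trans (antidiag-split-odd j (λ a b → coeff (F a ⊗ G b) (suc j)))
        (cong₂ _+_
          (antidiag-cong j _ _ (λ a b e →
             ⊗-top (F (suc (double a))) (G (double b)) (suc a) b (suc j) (odd-degree F dF a) (even-degree G dG b) (cong suc e)))
          (antidiag-cong j _ _ (λ a b e →
             ⊗-top (F (double a)) (G (suc (double b))) a (suc b) (suc j) (even-degree F dF a) (odd-degree G dG b) (suc-index e))))

-- Top coefficient of a product sum over an even total index: the terms with
-- two even indices fall one degree short, those with two odd indices reach it.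
prodSum-top-even : ∀ F G → HalfDegree F → HalfDegree G → ∀ j →
  prodSum F G (double (suc j)) (suc (suc j)) ≡ conv (oddTop F) (oddTop G) j
prodSum-top-even F G dF dG j =
  trans (antidiag-split-even j (λ a b → coeff (F a ⊗ G b) (suc (suc j))))
        (cong₂ _+_
          (antidiag-vanish (suc j) _ (λ a b e →
             ⊗-degree (F (double a)) (G (double b)) a b (even-degree F dF a) (even-degree G dG b)
                      (suc (suc j)) (subst (_< suc (suc j)) (sym e) (n<1+n (suc j)))))
          (antidiag-cong j _ _ (λ a b e →
             ⊗-top (F (suc (double a))) (G (suc (double b))) (suc a) (suc b) (suc (suc j))
                   (odd-degree F dF a) (odd-degree G dG b) (cong suc (suc-index e)))))

shift-odd-top : ∀ F → HalfDegree F → ∀ j → coeff (shift (F (suc (double j)))) (suc j) ≡ oddTop F j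
shift-odd-top F dF j = proj₂ (shift-leading (F (suc (double j))) (suc j) (odd-degree F dF j))

shift-even-above : ∀ F → HalfDegree F → ∀ j → coeff (shift (F (double (suc j)))) (suc (suc j)) ≡ 0
shift-even-above F dF j =
  proj₁ (shift-leading (F (double (suc j))) (suc j) (even-degree F dF (suc j))) (suc (suc j)) (n<1+n (suc j))

Q-oddTop-rec : ∀ j → oddTop Q (suc j) ≡ conv (oddTop Q) (oddTop P) j
Q-oddTop-rec j = trans (Q-rec (suc (double j)) (suc (suc j))) (prodSum-top-even Q P Q-degree P-degree j)

Q-evenTop-rec : ∀ j → evenTop Q (suc j) ≡ conv (oddTop Q) (evenTop P) j + conv (evenTop Q) (oddTop P) j
Q-evenTop-rec j = trans (Q-rec (double j) (suc j)) (prodSum-top-odd Q P Q-degree P-degree j)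

P-evenTop-rec : ∀ j → evenTop P (suc j) ≡ oddTop P j + evenTop Q (suc j)
P-evenTop-rec j = trans (P-rec (double j) (suc j))
  (cong₂ _+_ (shift-odd-top P P-degree j) (sym (Q-rec (double j) (suc j))))

oddTop-P≡Q : ∀ j → oddTop P j ≡ oddTop Q j
oddTop-P≡Q zero    = refl
oddTop-P≡Q (suc j) = trans (P-rec (suc (double j)) (suc (suc j)))
  (trans (cong₂ _+_ (shift-even-above P P-degree j) refl) (sym (Q-rec (suc (double j)) (suc (suc j)))))

P-oddTop-catalan : ∀ j → oddTop P (suc j) ≡ conv (oddTop P) (oddTop P) j
P-oddTop-catalan j = begin
  oddTop P (suc j)                    ≡⟨ oddTop-P≡Q (suc j) ⟩
  oddTop Q (suc j)                    ≡⟨ Q-oddTop-rec j ⟩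
  conv (oddTop Q) (oddTop P) j        ≡⟨ conv-cong j _ _ _ _ (λ x → sym (oddTop-P≡Q x)) (λ _ → refl) ⟩
  conv (oddTop P) (oddTop P) j        ∎

PT-oddTop-catalan : ∀ j → oddTop PT (suc j) ≡ conv (oddTop PT) (oddTop PT) j
PT-oddTop-catalan j = trans (PT-rec (suc (double j)) (suc (suc j)))
  (cong₂ _+_ (shift-even-above PT PT-degree j) (prodSum-top-even PT PT PT-degree PT-degree j))

PT-evenTop-rec : ∀ j → evenTop PT (suc j) ≡ oddTop PT j + (conv (oddTop PT) (evenTop PT) j + conv (evenTop PT) (oddTop PT) j)
PT-evenTop-rec j = trans (PT-rec (double j) (suc j))
  (cong₂ _+_ (shift-odd-top PT PT-degree j) (prodSum-top-odd PT PT PT-degree PT-degree j))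

P-evenTop : ∀ j → evenTop P (suc j) ≡ ballot 0 j
P-evenTop = Catalan.coupled-solution (oddTop P) refl P-oddTop-catalan
  (evenTop P) (evenTop Q) refl refl P-evenTop-rec Q-evenTop-rec′
  where
  Q-evenTop-rec′ : ∀ j → evenTop Q (suc j) ≡ conv (oddTop P) (evenTop P) j + conv (evenTop Q) (oddTop P) j
  Q-evenTop-rec′ j = trans (Q-evenTop-rec j)
    (cong (_+ conv (evenTop Q) (oddTop P) j) (conv-cong j _ _ _ _ (λ x → sym (oddTop-P≡Q x)) (λ _ → refl)))

PT-evenTop : ∀ j → evenTop PT (suc j) ≡ ballot 1 j
PT-evenTop = Catalan.symmetric-solution (oddTop PT) refl PT-oddTop-catalan (evenTop PT) refl PT-evenTop-rec

2*q+2*k≡double : ∀ q k → 2 * q + 2 * k ≡ double (k + q)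
2*q+2*k≡double q k = begin
  2 * q + 2 * k   ≡⟨ +-comm (2 * q) (2 * k) ⟩
  2 * k + 2 * q   ≡⟨ sym (*-distribˡ-+ 2 k q) ⟩
  2 * (k + q)     ≡⟨ sym (double≡2* (k + q)) ⟩
  double (k + q)  ∎

2*q+1≡suc-double : ∀ q → 2 * q + 1 ≡ suc (double q)
2*q+1≡suc-double q = trans (+-comm (2 * q) 1) (cong suc (sym (double≡2* q)))

P-leading : ∀ q → LeadingCoeff (P (2 * q + 4)) (q + 2) (2 * ((2 * q + 1) C q))
P-leading q rewrite 2*q+2*k≡double q 2 | +-comm q 2 | 2*q+1≡suc-double q =
  even-degree P P-degree (suc (suc q)) , trans (P-evenTop (suc q)) (ballot-central q)

PT-leading : ∀ q → LeadingCoeff (PT (2 * q + 2)) (q + 1) ((2 * q + 1) C (q + 1))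
PT-leading q rewrite 2*q+2*k≡double q 1 | +-comm q 1 | 2*q+1≡suc-double q =
  even-degree PT PT-degree (suc q) , trans (PT-evenTop q) (sym (middle-binomials q))

middle-binomials′ : ∀ q → (2 * q + 1) C q ≡ (2 * q + 1) C (q + 1)
middle-binomials′ q rewrite 2*q+1≡suc-double q | +-comm q 1 = sym (middle-binomials q)

mainTheorem9 : LeadingCoeff (P 2) 1 1
               × (∀ (q : ℕ) → LeadingCoeff (P (2 * q + 4)) (q + 2) (2 * ((2 * q + 1) C q))
                              × LeadingCoeff (PT (2 * q + 2)) (q + 1) ((2 * q + 1) C (q + 1))
                              × coeff (P (2 * q + 4)) (q + 2) ≡ 2 * coeff (PT (2 * q + 2)) (q + 1))
mainTheorem9 = (even-degree P P-degree 1 , refl) , λ q → P-leading q , PT-leading q , twice q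
  where
  twice : ∀ q → coeff (P (2 * q + 4)) (q + 2) ≡ 2 * coeff (PT (2 * q + 2)) (q + 1)
  twice q = begin
    coeff (P (2 * q + 4)) (q + 2)       ≡⟨ proj₂ (P-leading q) ⟩
    2 * ((2 * q + 1) C q)               ≡⟨ cong (2 *_) (middle-binomials′ q) ⟩
    2 * ((2 * q + 1) C (q + 1))         ≡⟨ cong (2 *_) (sym (proj₂ (PT-leading q))) ⟩
    2 * coeff (PT (2 * q + 2)) (q + 1)  ∎
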